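{- Let $G$ be a connected graph of order $n\ge 5$ with $rx_4(G)=3$. Then $\delta(G)\ge n-3$ and $\Delta(\overline{G})\le 2$; in other words, $\overline{G}$ is a disjoint union of paths (possibly trivial) and cycles.
   Context: For a connected graph $G$, an edge-coloring $c:E(G)\to\{1,\dots,q\}$ (adjacent edges may get the same color) is a $4$-rainbow coloring if for every set $S$ of $4$ vertices there is a tree in $G$ containing $S$ whose edges have pairwise distinct colors. $rx_4(G)$ is the minimum $q$ for which such a coloring exists. $\overline{G}$ is the complement of $G$; $\delta$ and $\Delta$ denote minimum and maximum degree. -}

module Defs where

open import Data.Nat using (ℕ; zero; suc; _+_; _∸_; _≤_; _<_)
open import Data.Fin using (Fin; toℕ)
open import Data.Fin.Properties using (_≟_)
open import Data.Bool using (Bool; true; false; not; _∧_; T?)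
open import Data.List using (List; length; filter; map; allFin)
open import Data.List.Membership.Propositional using (_∈_)
open import Data.List.Relation.Unary.Unique.Propositional using (Unique)
open import Data.Product using (Σ; _×_; _,_; proj₁; proj₂; ∃)
open import Data.Sum using (_⊎_)
open import Relation.Binary.PropositionalEquality using (_≡_)
open import Relation.Nullary using (¬_; does)

record Graph (n : ℕ) : Set where
  field
    adj     : Fin n → Fin n → Bool
    adj-sym : ∀ u v → adj u v ≡ adj v u
    adj-irr : ∀ v → adj v v ≡ false
open Graph public

data GWalk {n : ℕ} (G : Graph n) : Fin n → Fin n → Set where
  gnil  : ∀ {x} → GWalk G x x
  gcons : ∀ {x z y} → adj G x z ≡ true → GWalk G z y → GWalk G x y

Connected : ∀ {n} → Graph n → Set
Connected G = ∀ x y → GWalk G x y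

deg : ∀ {n} → Graph n → Fin n → ℕ
deg {n} G v = length (filter (λ u → T? (adj G v u)) (allFin n))

complement : ∀ {n} → Graph n → Graph n
complement {n} G = record
  { adj = λ u v → not (adj G u v) ∧ not (does (u ≟ v))
  ; adj-sym = λ u v → sym-lem u v
  ; adj-irr = λ v → irr v }
  where
  open import Relation.Binary.PropositionalEquality using (refl; cong; cong₂)
  open import Relation.Nullary using (yes; no)
  open import Relation.Binary.PropositionalEquality using (sym)
  dsym : ∀ (u v : Fin n) → does (u ≟ v) ≡ does (v ≟ u)
  dsym u v with u ≟ v | v ≟ u
  ... | yes _ | yes _ = refl
  ... | no _  | no _  = refl
  ... | yes p | no q  = Data.Empty.⊥-elim (q (sym p)) where import Data.Empty
  ... | no p  | yes q = Data.Empty.⊥-elim (p (sym q)) where import Data.Empty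
  sym-lem : ∀ u v → (not (adj G u v) ∧ not (does (u ≟ v))) ≡ (not (adj G v u) ∧ not (does (v ≟ u)))
  sym-lem u v = cong₂ (λ a b → not a ∧ not b) (adj-sym G u v) (dsym u v)
  irr : ∀ v → (not (adj G v v) ∧ not (does (v ≟ v))) ≡ false
  irr v with v ≟ v
  ... | yes _ = Data.Bool.Properties.∧-zeroʳ (not (adj G v v))
    where import Data.Bool.Properties
  ... | no ¬p = Data.Empty.⊥-elim (¬p refl) where import Data.Empty

-- An edge-colouring with colours Fin q (colour set {1,…,q}); it is given on all
-- ordered pairs, symmetric, and only its values on edges of G matter.
record Coloring {n : ℕ} (G : Graph n) (q : ℕ) : Set where
  field
    col     : Fin n → Fin n → Fin q
    col-sym : ∀ u v → col u v ≡ col v u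
open Coloring public

-- an edge list: each edge written (u , v) with u < v
EdgeList : ℕ → Set
EdgeList n = List (Fin n × Fin n)

data TWalk {n : ℕ} (es : EdgeList n) : Fin n → Fin n → Set where
  tnil  : ∀ {x} → TWalk es x x
  tcons : ∀ {x z y} → ((x , z) ∈ es ⊎ (z , x) ∈ es) → TWalk es z y → TWalk es x y

record TreeIn {n : ℕ} (G : Graph n) : Set where
  field
    verts      : List (Fin n)
    edges      : EdgeList n
    verts-uniq : Unique verts
    edges-uniq : Unique edges
    edge-ord   : ∀ {u v} → (u , v) ∈ edges → toℕ u < toℕ v
    edge-adj   : ∀ {u v} → (u , v) ∈ edges → adj G u v ≡ true
    edge-verts : ∀ {u v} → (u , v) ∈ edges → u ∈ verts × v ∈ verts
    connected  : ∀ {x y} → x ∈ verts → y ∈ verts → TWalk edges x y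
    tree-count : length edges + 1 ≡ length verts
open TreeIn public

Rainbow : ∀ {n q} {G : Graph n} → Coloring G q → TreeIn G → Set
Rainbow c T = Unique (map (λ e → col c (proj₁ e) (proj₂ e)) (edges T))

IsKRainbow : ∀ {n q} (k : ℕ) (G : Graph n) → Coloring G q → Set
IsKRainbow {n} k G c =
  ∀ (S : List (Fin n)) → Unique S → length S ≡ k →
  Σ (TreeIn G) λ T → (∀ {x} → x ∈ S → x ∈ verts T) × Rainbow c T

RxEq : ∀ {n} (k : ℕ) → Graph n → ℕ → Set
RxEq k G r =
  Σ (Coloring G r) (IsKRainbow k G) ×
  (∀ q → q < r → ¬ Σ (Coloring G q) (IsKRainbow k G))

-- A rainbow tree has at most as many edges as there are colours, so with three colours
-- every rainbow tree has at most four vertices. If a vertex v had three non-neighbours,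
-- a rainbow tree spanning v and them would also contain a neighbour of v (its edge
-- leaving v), hence five vertices. So v has at most two non-neighbours besides itself,
-- which is both Δ(Ḡ) ≤ 2 and δ(G) ≥ n − 3.
module Submission where

open import Defs
open import Data.Nat using (ℕ; _≤_; _∸_)
open import Data.Fin using (Fin)
open import Data.Product using (_×_)

open import Data.Nat using (suc; _+_; z≤n; s≤s; _≤?_)
open import Data.Nat.Properties
  using (≤-trans; ≤-refl; +-monoʳ-≤; +-comm; m≤n⇒m⊓n≡m; ≰⇒>; <⇒≱; m≤n+o⇒m∸n≤o; module ≤-Reasoning)
open import Data.Fin.Properties using (_≟_)
open import Data.Bool using (true; false; T?)
open import Data.Bool.Properties using (T-≡)
open import Function.Bundles using (module Equivalence)
open import Data.Empty using (⊥; ⊥-elim)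
open import Data.List using (List; []; _∷_; _++_; length; filter; map; take; allFin)
open import Data.List.Properties using (filter-notAll; length-map; length-++; length-take; length-tabulate)
open import Data.List.Membership.Propositional using (_∈_)
open import Data.List.Membership.Propositional.Properties using (∈-filter⁺; ∈-filter⁻; ∈-allFin; ∈-++⁺ˡ; ∈-++⁺ʳ)
open import Data.List.Relation.Binary.Subset.Propositional using (_⊆_)
open import Data.List.Relation.Unary.Any using (here; there)
import Data.List.Relation.Unary.Any as Any
open import Data.List.Relation.Unary.All using (All; _∷_)
import Data.List.Relation.Unary.All as All
import Data.List.Relation.Unary.All.Properties as All
open import Data.List.Relation.Unary.AllPairs using (_∷_)
open import Data.List.Relation.Unary.Unique.Propositional using (Unique)
import Data.List.Relation.Unary.Unique.Propositional.Properties as Unique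
open import Data.Product using (∃; _,_; proj₁; proj₂)
open import Data.Sum using (_⊎_; inj₁; inj₂)
open import Relation.Binary.Definitions using (DecidableEquality)
open import Relation.Binary.PropositionalEquality using (_≡_; _≢_; refl; sym; trans; cong)
open import Relation.Nullary using (yes; no; ¬?)

Unique-⊆⇒length≤ : ∀ {a} {A : Set a} → DecidableEquality A → {xs ys : List A} →
                    Unique xs → xs ⊆ ys → length xs ≤ length ys
Unique-⊆⇒length≤ _≟_ {[]} _ _ = z≤n
Unique-⊆⇒length≤ _≟_ {x ∷ xs} {ys} (x∉xs ∷ uniq) x∷xs⊆ys =
  ≤-trans (s≤s (Unique-⊆⇒length≤ _≟_ uniq xs⊆ys-x))
          (filter-notAll ≢x? ys (Any.map (λ { refl x≢x → x≢x refl }) (x∷xs⊆ys (here refl))))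
  where
  ≢x? = λ y → ¬? (x ≟ y)
  xs⊆ys-x : xs ⊆ filter ≢x? ys
  xs⊆ys-x z∈xs = ∈-filter⁺ ≢x? (x∷xs⊆ys (there z∈xs)) (All.lookup x∉xs z∈xs)

-- Chosen so that deg G v is definitionally length (neighbours G v).
neighbours : ∀ {n} → Graph n → Fin n → List (Fin n)
neighbours {n} G v = filter (λ u → T? (adj G v u)) (allFin n)

module _ {n : ℕ} (G : Graph n) where

  Unique-neighbours : ∀ v → Unique (neighbours G v)
  Unique-neighbours v = Unique.filter⁺ _ (Unique.allFin⁺ n)

  ∈-neighbours⁺ : ∀ {v u} → adj G v u ≡ true → u ∈ neighbours G v
  ∈-neighbours⁺ {v} {u} vu = ∈-filter⁺ (λ u → T? (adj G v u)) (∈-allFin u) (Equivalence.from T-≡ vu)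

  ∈-neighbours⁻ : ∀ {v u} → u ∈ neighbours G v → adj G v u ≡ true
  ∈-neighbours⁻ {v} u∈ = Equivalence.to T-≡ (proj₂ (∈-filter⁻ (λ u → T? (adj G v u)) {xs = allFin n} u∈))

  complement-adj⇒¬adj : ∀ {u v} → adj (complement G) u v ≡ true → adj G u v ≡ false
  complement-adj⇒¬adj {u} {v} uv with adj G u v
  ... | false = refl

  complement-adj⇒≢ : ∀ {u v} → adj (complement G) u v ≡ true → u ≢ v
  complement-adj⇒≢ {u} {v} uv u≡v with adj G u v | u ≟ v
  ... | false | no u≢v = u≢v u≡v

  adj⊎complement-adj⊎≡ : ∀ u v → adj G u v ≡ true ⊎ adj (complement G) u v ≡ true ⊎ u ≡ v
  adj⊎complement-adj⊎≡ u v with adj G u v | u ≟ v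
  ... | true  | _       = inj₁ refl
  ... | false | no _    = inj₂ (inj₁ refl)
  ... | false | yes u≡v = inj₂ (inj₂ u≡v)

order≤1+deg+deg-complement : ∀ {n} (G : Graph n) v → n ≤ suc (deg G v + deg (complement G) v)
order≤1+deg+deg-complement {n} G v = begin
  n                                                    ≡⟨ length-tabulate (λ u → u) ⟨
  length (allFin n)                                    ≤⟨ Unique-⊆⇒length≤ _≟_ (Unique.allFin⁺ n) covers ⟩
  length (v ∷ neighbours G v ++ neighbours Gᶜ v)       ≡⟨ cong suc (length-++ (neighbours G v)) ⟩
  suc (deg G v + deg Gᶜ v)                             ∎
  where
  open ≤-Reasoning
  Gᶜ = complement G
  covers : allFin n ⊆ v ∷ neighbours G v ++ neighbours Gᶜ v
  covers {u} _ with adj⊎complement-adj⊎≡ G v u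
  ... | inj₁ vu          = there (∈-++⁺ˡ (∈-neighbours⁺ G vu))
  ... | inj₂ (inj₁ vu)   = there (∈-++⁺ʳ (neighbours G v) (∈-neighbours⁺ Gᶜ vu))
  ... | inj₂ (inj₂ refl) = here refl

module _ {n : ℕ} {G : Graph n} where

  rainbow-tree-order≤ : ∀ {q} (c : Coloring G q) (T : TreeIn G) → Rainbow c T → length (verts T) ≤ suc q
  rainbow-tree-order≤ {q} c T rainbow = begin
    length (verts T)                   ≡⟨ tree-count T ⟨
    length (edges T) + 1               ≡⟨ +-comm (length (edges T)) 1 ⟩
    suc (length (edges T))             ≡⟨ cong suc (length-map colour (edges T)) ⟨
    suc (length (map colour (edges T))) ≤⟨ s≤s (Unique-⊆⇒length≤ _≟_ rainbow (λ {i} _ → ∈-allFin i)) ⟩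
    suc (length (allFin q))            ≡⟨ cong suc (length-tabulate (λ i → i)) ⟩
    suc q                              ∎
    where
    open ≤-Reasoning
    colour = λ (e : Fin n × Fin n) → col c (proj₁ e) (proj₂ e)

  tree-neighbour : ∀ (T : TreeIn G) {x y} → x ∈ verts T → y ∈ verts T → x ≢ y →
                   ∃ λ z → adj G x z ≡ true × z ∈ verts T
  tree-neighbour T {x} {y} x∈T y∈T x≢y = first-step (connected T x∈T y∈T)
    where
    first-step : TWalk (edges T) x y → ∃ λ z → adj G x z ≡ true × z ∈ verts T
    first-step tnil                 = ⊥-elim (x≢y refl)
    first-step (tcons (inj₁ xz) _) = _ , edge-adj T xz , proj₂ (edge-verts T xz)
    first-step (tcons (inj₂ zx) _) = _ , trans (adj-sym G _ _) (edge-adj T zx) , proj₁ (edge-verts T zx)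

  tree-order≥2+non-neighbours : ∀ (T : TreeIn G) {v a L} → Unique (a ∷ L) →
                                All (λ u → adj (complement G) v u ≡ true) (a ∷ L) →
                                v ∷ a ∷ L ⊆ verts T → suc (length (v ∷ a ∷ L)) ≤ length (verts T)
  tree-order≥2+non-neighbours T {v} {a} {L} uniq-aL non-adj@(va ∷ _) S⊆T =
    Unique-⊆⇒length≤ _≟_ uniq-zS zS⊆T
    where
    neighbour = tree-neighbour T (S⊆T (here refl)) (S⊆T (there (here refl))) (complement-adj⇒≢ G va)
    z = proj₁ neighbour
    z≢ : ∀ {u} → adj G v u ≡ false → z ≢ u
    z≢ vu refl with trans (sym (proj₁ (proj₂ neighbour))) vu
    ... | ()
    uniq-S : Unique (v ∷ a ∷ L)
    uniq-S = All.map (complement-adj⇒≢ G) non-adj ∷ uniq-aL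
    uniq-zS : Unique (z ∷ v ∷ a ∷ L)
    uniq-zS = (z≢ (adj-irr G v) ∷ All.map (λ vu → z≢ (complement-adj⇒¬adj G vu)) non-adj) ∷ uniq-S
    zS⊆T : z ∷ v ∷ a ∷ L ⊆ verts T
    zS⊆T (here refl) = proj₂ (proj₂ neighbour)
    zS⊆T (there u∈S) = S⊆T u∈S

module _ {n p : ℕ} {G : Graph n} {c : Coloring G (suc p)} (rainbow : IsKRainbow (suc (suc p)) G c) where

  IsKRainbow⇒¬suc-non-neighbours : ∀ v (L : List (Fin n)) → Unique L → length L ≡ suc p →
                                   All (λ u → adj (complement G) v u ≡ true) L → ⊥
  IsKRainbow⇒¬suc-non-neighbours v L@(_ ∷ _) uniq-L |L|≡ non-adj =
    <⇒≱ (s≤s (s≤s (s≤s ≤-refl))) (begin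
      suc (suc (suc p))   ≡⟨ cong (λ m → suc (suc m)) |L|≡ ⟨
      suc (length (v ∷ L)) ≤⟨ tree-order≥2+non-neighbours T uniq-L non-adj S⊆T ⟩
      length (verts T)     ≤⟨ rainbow-tree-order≤ c T rainbow-T ⟩
      suc (suc p)          ∎)
    where
    open ≤-Reasoning
    spanning = rainbow (v ∷ L) (All.map (complement-adj⇒≢ G) non-adj ∷ uniq-L) (cong suc |L|≡)
    T = proj₁ spanning
    S⊆T = proj₁ (proj₂ spanning)
    rainbow-T = proj₂ (proj₂ spanning)

  IsKRainbow⇒deg-complement≤ : ∀ v → deg (complement G) v ≤ p
  IsKRainbow⇒deg-complement≤ v with deg (complement G) v ≤? p
  ... | yes deg≤p = deg≤p
  ... | no  deg≰p = ⊥-elim (IsKRainbow⇒¬suc-non-neighbours v (take (suc p) Nᶜ)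
                             (Unique.take⁺ (suc p) (Unique-neighbours (complement G) v))
                             (trans (length-take (suc p) Nᶜ) (m≤n⇒m⊓n≡m (≰⇒> deg≰p)))
                             (All.take⁺ (suc p) (All.tabulate (∈-neighbours⁻ (complement G)))))
    where Nᶜ = neighbours (complement G) v

  IsKRainbow⇒deg≥ : ∀ v → n ∸ suc p ≤ deg G v
  IsKRainbow⇒deg≥ v = m≤n+o⇒m∸n≤o n (suc p) (begin
    n                                    ≤⟨ order≤1+deg+deg-complement G v ⟩
    suc (deg G v + deg (complement G) v) ≤⟨ s≤s (+-monoʳ-≤ (deg G v) (IsKRainbow⇒deg-complement≤ v)) ⟩
    suc (deg G v + p)                    ≡⟨ cong suc (+-comm (deg G v) p) ⟩
    suc p + deg G v                      ∎)
    where open ≤-Reasoning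

proposition2p2 : ∀ (n : ℕ) (G : Graph n) → 5 ≤ n → Connected G → RxEq 4 G 3 →
    (∀ (v : Fin n) → n ∸ 3 ≤ deg G v) × (∀ (v : Fin n) → deg (complement G) v ≤ 2)
proposition2p2 n G _ _ ((c , rainbow) , _) =
  IsKRainbow⇒deg≥ {G = G} {c} rainbow , IsKRainbow⇒deg-complement≤ {G = G} {c} rainbow
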